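{- The theories \textsf{MLSS}, \textsf{MLSP}, \textsf{MLSSP}, \textsf{MLSU}, $\textsf{MLS}\times$, $\textsf{MLS}\otimes$, $\textsf{BST}\times$, and $\textsf{BST}\otimes$ are all non-convex.
   Context: \textsf{MLS} is the quantifier-free propositional closure of atoms $x = \varnothing$, $x = y$, $x \subseteq y$, $x \in y$, $x = y \setminus z$, $x = y \cup z$, $x = y \cap z$ over set variables, interpreted via set assignments (maps from finitely many set variables into the von Neumann universe) with the standard set-theoretic meaning. \textsf{BST} is the analogous Boolean language without the membership relator (literals built from set variables with $\cup,\cap,\setminus$ and the relations $=\varnothing$, $\neq\varnothing$, disjointness and its negation, $\subseteq$, $\not\subseteq$, $=$, $\neq$). The extensions are: \textsf{MLSS} = \textsf{MLS} plus the singleton operator (atoms $x = \{y\}$); \textsf{MLSP} = \textsf{MLS} plus the powerset operator $\mathcal{P}$; \textsf{MLSSP} = \textsf{MLS} plus both singleton and powerset; \textsf{MLSU} = \textsf{MLS} plus the general union operator $\bigcup$ (with $\bigcup y = \{a : a \in b \text{ for some } b \in y\}$); $\textsf{MLS}\times$ (resp. $\textsf{BST}\times$) = \textsf{MLS} (resp. \textsf{BST}) plus the Cartesian product operator $x \times y$; $\textsf{MLS}\otimes$ (resp. $\textsf{BST}\otimes$) = \textsf{MLS} (resp. \textsf{BST}) plus the unordered Cartesian product $x \otimes y = \{\{a,b\} : a \in x, b \in y\}$. $\models \psi$ means $\psi$ is true under every set assignment. A theory is convex if for every conjunction of literals $\varphi$ and every finite nonempty set of equalities $x_1=y_1,\ldots,x_n=y_n$,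 $\models \varphi \rightarrow \bigvee_{i} x_i = y_i$ implies $\models \varphi \rightarrow x_i = y_i$ for some $i$. -}

module Defs where

open import Level using (Level; 0ℓ; Lift) renaming (suc to lsuc)
open import Data.Nat using (ℕ)
open import Data.Product using (Σ; _×_; _,_; proj₁; proj₂)
open import Data.Sum using (_⊎_; inj₁; inj₂)
open import Data.Unit using (⊤)
open import Data.Bool using (Bool; if_then_else_)
open import Data.Empty using (⊥; ⊥-elim)
open import Relation.Nullary using (¬_)
open import Data.List using (List; [_])
open import Data.List.NonEmpty using (List⁺; toList)
open import Data.List.Relation.Unary.All using (All)
open import Data.List.Relation.Unary.Any using (Any)
open import Relation.Binary.PropositionalEquality using (_≡_)

-- The set-theoretic universe: Aczel's cumulative hierarchy of
-- well-founded sets (W-type), with extensional equality _≐_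
-- (bisimulation) and membership _∈_.

data V : Set₁ where
  sup : (I : Set) → (I → V) → V

Idx : V → Set
Idx (sup I f) = I

el : (a : V) → Idx a → V
el (sup I f) i = f i

infix 4 _≐_ _∈_ _⊆_

_≐_ : V → V → Set
sup I f ≐ sup J g =
  ((i : I) → Σ J λ j → f i ≐ g j) × ((j : J) → Σ I λ i → f i ≐ g j)

_∈_ : V → V → Set
a ∈ sup I f = Σ I λ i → a ≐ f i

_⊆_ : V → V → Set₁
a ⊆ b = (z : V) → z ∈ a → z ∈ b

∅V : V
∅V = sup ⊥ ⊥-elim

_∪V_ : V → V → V
sup I f ∪V sup J g = sup (I ⊎ J) (λ { (inj₁ i) → f i ; (inj₂ j) → g j })

_∩V_ : V → V → V
sup I f ∩V b = sup (Σ I λ i → f i ∈ b) (λ p → f (proj₁ p))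

_∖V_ : V → V → V
sup I f ∖V b = sup (Σ I λ i → ¬ (f i ∈ b)) (λ p → f (proj₁ p))

singV : V → V
singV a = sup ⊤ (λ _ → a)

upairV : V → V → V
upairV a b = sup Bool (λ t → if t then a else b)

opairV : V → V → V
opairV a b = upairV (singV a) (upairV a b)

⋃V : V → V
⋃V (sup I f) = sup (Σ I λ i → Idx (f i)) (λ p → el (f (proj₁ p)) (proj₂ p))

_×V_ : V → V → V
sup I f ×V sup J g = sup (I × J) (λ p → opairV (f (proj₁ p)) (g (proj₂ p)))

_⊗V_ : V → V → V
sup I f ⊗V sup J g = sup (I × J) (λ p → upairV (f (proj₁ p)) (g (proj₂ p)))

IsPow : V → V → Set₁
IsPow x y = (z : V) → (z ∈ x → z ⊆ y) × (z ⊆ y → z ∈ x)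

Assignment : Set₁
Assignment = ℕ → V

record Theory : Set₂ where
  field
    Lit  : Set
    ⟦_⟧  : Lit → Assignment → Set₁

module _ (T : Theory) where
  open Theory T

  Entails : List Lit → List (ℕ × ℕ) → Set₁
  Entails φ es = (M : Assignment) → All (λ l → ⟦ l ⟧ M) φ →
                 Any (λ e → M (proj₁ e) ≐ M (proj₂ e)) es

  Convex : Set₁
  Convex = (φ : List Lit) (es : List⁺ (ℕ × ℕ)) →
           Entails φ (toList es) → Any (λ e → Entails φ [ e ]) (toList es)

data Literal (A : Set) : Set where
  pos : A → Literal A
  neg : A → Literal A

litSem : {A : Set} → (A → Assignment → Set₁) → Literal A → Assignment → Set₁
litSem s (pos a) M = s a M
litSem s (neg a) M = ¬ s a M

data Op : Set where
  singOp powOp bigUOp prodOp uprodOp : Op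

-- MLS with extensions: flat atoms over variables; S selects the
-- admitted extra operators.

data MAtom (S : Op → Set) : Set where
  isEmp   : ℕ → MAtom S
  eqA     : ℕ → ℕ → MAtom S
  subA    : ℕ → ℕ → MAtom S
  memA    : ℕ → ℕ → MAtom S
  diffA   : ℕ → ℕ → ℕ → MAtom S
  unionA  : ℕ → ℕ → ℕ → MAtom S
  interA  : ℕ → ℕ → ℕ → MAtom S
  singA   : S singOp  → ℕ → ℕ → MAtom S
  powA    : S powOp   → ℕ → ℕ → MAtom S
  bigUA   : S bigUOp  → ℕ → ℕ → MAtom S
  prodA   : S prodOp  → ℕ → ℕ → ℕ → MAtom S
  uprodA  : S uprodOp → ℕ → ℕ → ℕ → MAtom S

L : Set → Set₁
L A = Lift (lsuc 0ℓ) A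

mSem : {S : Op → Set} → MAtom S → Assignment → Set₁
mSem (isEmp x)        M = L (M x ≐ ∅V)
mSem (eqA x y)        M = L (M x ≐ M y)
mSem (subA x y)       M = M x ⊆ M y
mSem (memA x y)       M = L (M x ∈ M y)
mSem (diffA x y z)    M = L (M x ≐ (M y ∖V M z))
mSem (unionA x y z)   M = L (M x ≐ (M y ∪V M z))
mSem (interA x y z)   M = L (M x ≐ (M y ∩V M z))
mSem (singA _ x y)    M = L (M x ≐ singV (M y))
mSem (powA _ x y)     M = IsPow (M x) (M y)
mSem (bigUA _ x y)    M = L (M x ≐ ⋃V (M y))
mSem (prodA _ x y z)  M = L (M x ≐ (M y ×V M z))
mSem (uprodA _ x y z) M = L (M x ≐ (M y ⊗V M z))

MLSwith : (Op → Set) → Theory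
MLSwith S = record { Lit = Literal (MAtom S) ; ⟦_⟧ = litSem mSem }

-- BST with extensions: terms built from variables by ∪, ∩, ∖ (and
-- the admitted extra operators); literals are =∅, ≠∅, disjoint,
-- not disjoint, ⊆, ⊈, =, ≠ (atoms with polarity).

data BTerm (S : Op → Set) : Set where
  var    : ℕ → BTerm S
  _∪ᵗ_   : BTerm S → BTerm S → BTerm S
  _∩ᵗ_   : BTerm S → BTerm S → BTerm S
  _∖ᵗ_   : BTerm S → BTerm S → BTerm S
  prodT  : S prodOp  → BTerm S → BTerm S → BTerm S
  uprodT : S uprodOp → BTerm S → BTerm S → BTerm S

eval : {S : Op → Set} → BTerm S → Assignment → V
eval (var x)        M = M x
eval (t ∪ᵗ s)       M = eval t M ∪V eval s M
eval (t ∩ᵗ s)       M = eval t M ∩V eval s M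
eval (t ∖ᵗ s)       M = eval t M ∖V eval s M
eval (prodT _ t s)  M = eval t M ×V eval s M
eval (uprodT _ t s) M = eval t M ⊗V eval s M

data BAtom (S : Op → Set) : Set where
  emptyB : BTerm S → BAtom S
  disjB  : BTerm S → BTerm S → BAtom S
  subB   : BTerm S → BTerm S → BAtom S
  eqB    : BTerm S → BTerm S → BAtom S

bSem : {S : Op → Set} → BAtom S → Assignment → Set₁
bSem (emptyB t)  M = L (eval t M ≐ ∅V)
bSem (disjB t s) M = (z : V) → z ∈ eval t M → ¬ (z ∈ eval s M)
bSem (subB t s)  M = eval t M ⊆ eval s M
bSem (eqB t s)   M = L (eval t M ≐ eval s M)

BSTwith : (Op → Set) → Theory
BSTwith S = record { Lit = Literal (BAtom S) ; ⟦_⟧ = litSem bSem }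

MLSS MLSP MLSSP MLSU MLS× MLS⊗ BST× BST⊗ : Theory
MLSS  = MLSwith (λ o → o ≡ singOp)
MLSP  = MLSwith (λ o → o ≡ powOp)
MLSSP = MLSwith (λ o → (o ≡ singOp) ⊎ (o ≡ powOp))
MLSU  = MLSwith (λ o → o ≡ bigUOp)
MLS×  = MLSwith (λ o → o ≡ prodOp)
MLS⊗  = MLSwith (λ o → o ≡ uprodOp)
BST×  = BSTwith (λ o → o ≡ prodOp)
BST⊗  = BSTwith (λ o → o ≡ uprodOp)

-- Convexity fails as soon as a conjunction φ entails a disjunction of two
-- equalities without entailing either one. With singleton, powerset or
-- general union, φ can force x = {∅} (as x = {e}, x = 𝒫 e, or e ∈ x and
-- ⋃ x = e, with e = ∅), and then z ⊆ x entails z = ∅ ∨ z = x; with a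
-- Cartesian or unordered product, x × y = ∅ entails x = ∅ ∨ y = ∅. Both
-- dichotomies are classical, and in each case {∅} supplies one model
-- refuting each disjunct.
module Submission where

open import Defs
open import Level using (0ℓ; Lift; lift) renaming (suc to lsuc)
open import Data.Product using (_×_; Σ; _,_; proj₁; proj₂)
open import Data.Sum using (_⊎_; inj₁; inj₂)
open import Data.Unit using (tt)
open import Data.Empty using (⊥-elim)
open import Data.Nat using (ℕ)
open import Data.List using (List; []; _∷_)
open import Data.List.NonEmpty using () renaming (_∷_ to _∷⁺_)
open import Data.List.Relation.Unary.All using (All) renaming ([] to []ᴬ; _∷_ to _∷ᴬ_)
open import Data.List.Relation.Unary.Any using (here; there)
open import Data.List.Relation.Unary.Any.Properties using (singleton⁻)
open import Relation.Nullary using (¬_; yes; no)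
open import Relation.Binary.PropositionalEquality using (refl)
open import Function using (id)
open import Function.Bundles using (_⇔_; mk⇔; Equivalence)
open import Axiom.ExcludedMiddle using (ExcludedMiddle)

≐-refl : (a : V) → a ≐ a
≐-refl (sup I f) = (λ i → i , ≐-refl (f i)) , (λ i → i , ≐-refl (f i))

≐-sym : {a b : V} → a ≐ b → b ≐ a
≐-sym {sup I f} {sup J g} (p , q) =
  (λ j → proj₁ (q j) , ≐-sym (proj₂ (q j))) ,
  (λ i → proj₁ (p i) , ≐-sym (proj₂ (p i)))

≐-trans : {a b c : V} → a ≐ b → b ≐ c → a ≐ c
≐-trans {sup I f} {sup J g} {sup K h} (p , q) (r , s) =
  (λ i → proj₁ (r (proj₁ (p i))) , ≐-trans (proj₂ (p i)) (proj₂ (r (proj₁ (p i))))) ,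
  (λ k → proj₁ (q (proj₁ (s k))) , ≐-trans (proj₂ (q (proj₁ (s k)))) (proj₂ (s k)))

∈-respʳ : {a b c : V} → a ∈ b → b ≐ c → a ∈ c
∈-respʳ {b = sup I f} {sup J g} (i , a≐fi) (p , q) =
  proj₁ (p i) , ≐-trans a≐fi (proj₂ (p i))

∈-respˡ : {a a′ b : V} → a ≐ a′ → a ∈ b → a′ ∈ b
∈-respˡ {b = sup I f} a≐a′ (i , a≐fi) = i , ≐-trans (≐-sym a≐a′) a≐fi

⊆-respʳ : {a b c : V} → a ⊆ b → b ≐ c → a ⊆ c
⊆-respʳ a⊆b b≐c z z∈a = ∈-respʳ (a⊆b z z∈a) b≐c

el∈ : (a : V) (i : Idx a) → el a i ∈ a
el∈ (sup I f) i = i , ≐-refl (f i)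

∈⇒≐el : {a b : V} → a ∈ b → Σ (Idx b) λ i → a ≐ el b i
∈⇒≐el {b = sup I f} a∈b = a∈b

≐-ext : (a b : V) → a ⊆ b → b ⊆ a → a ≐ b
≐-ext (sup I f) (sup J g) a⊆b b⊆a =
  (λ i → a⊆b (f i) (i , ≐-refl (f i))) ,
  (λ j → let (i , gj≐fi) = b⊆a (g j) (j , ≐-refl (g j)) in i , ≐-sym gj≐fi)

∉∅ : (a : V) → ¬ a ∈ ∅V
∉∅ a (() , _)

∉-≐∅ : {a e : V} → e ≐ ∅V → ¬ a ∈ e
∉-≐∅ e≐∅ a∈e = ∉∅ _ (∈-respʳ a∈e e≐∅)

memberless⇒≐∅ : (a : V) → ((u : V) → ¬ u ∈ a) → a ≐ ∅V
memberless⇒≐∅ a u∉a = ≐-ext a ∅V (λ u u∈a → ⊥-elim (u∉a u u∈a)) (λ u u∈∅ → ⊥-elim (∉∅ u u∈∅))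

¬Idx⇒≐∅ : (a : V) → ¬ Idx a → a ≐ ∅V
¬Idx⇒≐∅ (sup I f) ¬i = (λ i → ⊥-elim (¬i i)) , (λ ())

Idx⇒≉∅ : (a : V) → Idx a → ¬ a ≐ ∅V
Idx⇒≉∅ (sup I f) i (p , _) with p i
... | () , _

⊆-≐∅⇒≐∅ : {a e : V} → e ≐ ∅V → a ⊆ e → a ≐ ∅V
⊆-≐∅⇒≐∅ {a} e≐∅ a⊆e = memberless⇒≐∅ a (λ u u∈a → ∉-≐∅ e≐∅ (a⊆e u u∈a))

∈-⋃ : (x w u : V) → w ∈ x → u ∈ w → u ∈ ⋃V x
∈-⋃ (sup I f) w u (i , w≐fi) u∈w =
  let (k , u≐fik) = ∈⇒≐el (∈-respʳ u∈w w≐fi) in (i , k) , u≐fik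

𝒫-≐∅ : {x e : V} → e ≐ ∅V → IsPow x e → x ≐ singV e
𝒫-≐∅ {x} {e} e≐∅ x≡𝒫e = ≐-ext x (singV e)
  (λ w w∈x → tt , ≐-trans (⊆-≐∅⇒≐∅ e≐∅ (proj₁ (x≡𝒫e w) w∈x)) (≐-sym e≐∅))
  (λ w (_ , w≐e) → ∈-respˡ (≐-sym w≐e) (proj₂ (x≡𝒫e e) (λ u u∈e → u∈e)))

⋃-≐∅ : {x e : V} → e ≐ ∅V → e ∈ x → e ≐ ⋃V x → x ≐ singV e
⋃-≐∅ {x} {e} e≐∅ e∈x e≐⋃x = ≐-ext x (singV e)
  (λ w w∈x → tt , ≐-trans (memberless⇒≐∅ w (λ u u∈w →
      ∉-≐∅ (≐-trans (≐-sym e≐⋃x) e≐∅) (∈-⋃ x w u w∈x u∈w))) (≐-sym e≐∅))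
  (λ w (_ , w≐e) → ∈-respˡ (≐-sym w≐e) e∈x)

×V-Idx : (a b : V) → Idx (a ×V b) ⇔ (Idx a × Idx b)
×V-Idx (sup I f) (sup J g) = mk⇔ id id

⊗V-Idx : (a b : V) → Idx (a ⊗V b) ⇔ (Idx a × Idx b)
⊗V-Idx (sup I f) (sup J g) = mk⇔ id id

module _ (em : ExcludedMiddle (lsuc 0ℓ)) where

  ≐∅⊎Idx : (a : V) → a ≐ ∅V ⊎ Idx a
  ≐∅⊎Idx a with em {Lift (lsuc 0ℓ) (Idx a)}
  ... | yes (lift i) = inj₂ i
  ... | no ¬i = inj₁ (¬Idx⇒≐∅ a (λ i → ¬i (lift i)))

  ⊆-singleton : {a z : V} → z ⊆ singV a → z ≐ ∅V ⊎ z ≐ singV a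
  ⊆-singleton {a} {z} z⊆a with ≐∅⊎Idx z
  ... | inj₁ z≐∅ = inj₁ z≐∅
  ... | inj₂ i = inj₂ (≐-ext z (singV a) z⊆a (λ w (_ , w≐a) →
        ∈-respˡ (≐-trans (proj₂ (z⊆a _ (el∈ z i))) (≐-sym w≐a)) (el∈ z i)))

  product-≐∅ : (op : V → V → V) → (∀ a b → Idx (op a b) ⇔ (Idx a × Idx b)) →
               {a b : V} → op a b ≐ ∅V → a ≐ ∅V ⊎ b ≐ ∅V
  product-≐∅ op op-Idx {a} {b} ab≐∅ with ≐∅⊎Idx a | ≐∅⊎Idx b
  ... | inj₁ a≐∅ | _ = inj₁ a≐∅
  ... | inj₂ _ | inj₁ b≐∅ = inj₂ b≐∅
  ... | inj₂ i | inj₂ j = ⊥-elim (Idx⇒≉∅ (op a b) (Equivalence.from (op-Idx a b) (i , j)) ab≐∅)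

module _ (T : Theory) where
  open Theory T

  Models : List Lit → Assignment → Set₁
  Models φ M = All (λ l → ⟦ l ⟧ M) φ

  ¬Convex-binary : (φ : List Lit) (a b c d : ℕ) →
    Entails T φ ((a , b) ∷ (c , d) ∷ []) →
    (M : Assignment) → Models φ M → ¬ M a ≐ M b →
    (N : Assignment) → Models φ N → ¬ N c ≐ N d →
    ¬ Convex T
  ¬Convex-binary φ a b c d φ⊨ab∨cd M ⊨M Ma≉Mb N ⊨N Nc≉Nd convex
    with convex φ ((a , b) ∷⁺ ((c , d) ∷ [])) φ⊨ab∨cd
  ... | here φ⊨ab = Ma≉Mb (singleton⁻ (φ⊨ab M ⊨M))
  ... | there (here φ⊨cd) = Nc≉Nd (singleton⁻ (φ⊨cd N ⊨N))

sing∅ : V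
sing∅ = singV ∅V

∅≉sing∅ : ¬ ∅V ≐ sing∅
∅≉sing∅ (_ , q) with q tt
... | () , _

𝒫∅ : IsPow sing∅ ∅V
𝒫∅ w = (λ (_ , w≐∅) u u∈w → ⊥-elim (∉-≐∅ w≐∅ u∈w))
     , (λ w⊆∅ → tt , ⊆-≐∅⇒≐∅ (≐-refl ∅V) w⊆∅)

⋃sing∅ : ∅V ≐ ⋃V sing∅
⋃sing∅ = (λ ()) , (λ { (_ , ()) })

singletonModel : V → Assignment
singletonModel z 0 = ∅V
singletonModel z 1 = sing∅
singletonModel z 2 = z
singletonModel z _ = ∅V

productModel : V → V → Assignment
productModel x y 1 = x
productModel x y 2 = y
productModel x y _ = ∅V

module _ (em : ExcludedMiddle (lsuc 0ℓ)) (T : Theory) (φ : List (Theory.Lit T)) where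

  ¬Convex-⊆singleton :
    ((M : Assignment) → Models T φ M → M 0 ≐ ∅V × M 1 ≐ singV (M 0) × M 2 ⊆ M 1) →
    ((z : V) → z ⊆ sing∅ → Models T φ (singletonModel z)) →
    ¬ Convex T
  ¬Convex-⊆singleton φ⇒z⊆x≐sing∅ z⊆sing∅⇒φ =
    ¬Convex-binary T φ 2 0 2 1 φ⊨z≐∅∨z≐x
      (singletonModel sing∅) (z⊆sing∅⇒φ sing∅ (λ _ m → m)) (λ p → ∅≉sing∅ (≐-sym p))
      (singletonModel ∅V) (z⊆sing∅⇒φ ∅V (λ u m → ⊥-elim (∉∅ u m))) ∅≉sing∅
    where
    φ⊨z≐∅∨z≐x : Entails T φ ((2 , 0) ∷ (2 , 1) ∷ [])
    φ⊨z≐∅∨z≐x M ⊨M with φ⇒z⊆x≐sing∅ M ⊨M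
    ... | e≐∅ , x≐sing-e , z⊆x with ⊆-singleton em (⊆-respʳ z⊆x x≐sing-e)
    ...   | inj₁ z≐∅ = here (≐-trans z≐∅ (≐-sym e≐∅))
    ...   | inj₂ z≐sing-e = there (here (≐-trans z≐sing-e (≐-sym x≐sing-e)))

  ¬Convex-product : (op : V → V → V) → (∀ a b → Idx (op a b) ⇔ (Idx a × Idx b)) →
    ((M : Assignment) → Models T φ M → M 0 ≐ ∅V × op (M 1) (M 2) ≐ ∅V) →
    ((x y : V) → op x y ≐ ∅V → Models T φ (productModel x y)) →
    ¬ Convex T
  ¬Convex-product op op-Idx φ⇒xy≐∅ xy≐∅⇒φ =
    ¬Convex-binary T φ 1 0 2 0 φ⊨x≐∅∨y≐∅
      (productModel sing∅ ∅V) (xy≐∅⇒φ sing∅ ∅V (≐∅-if-factor (λ { (_ , ()) }))) sing∅≉∅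
      (productModel ∅V sing∅) (xy≐∅⇒φ ∅V sing∅ (≐∅-if-factor (λ { (() , _) }))) sing∅≉∅
    where
    sing∅≉∅ : ¬ sing∅ ≐ ∅V
    sing∅≉∅ p = ∅≉sing∅ (≐-sym p)

    ≐∅-if-factor : {x y : V} → ¬ (Idx x × Idx y) → op x y ≐ ∅V
    ≐∅-if-factor {x} {y} ¬ij = ¬Idx⇒≐∅ (op x y) (λ k → ¬ij (Equivalence.to (op-Idx x y) k))

    φ⊨x≐∅∨y≐∅ : Entails T φ ((1 , 0) ∷ (2 , 0) ∷ [])
    φ⊨x≐∅∨y≐∅ M ⊨M with φ⇒xy≐∅ M ⊨M
    ... | e≐∅ , xy≐∅ with product-≐∅ em op op-Idx xy≐∅
    ...   | inj₁ x≐∅ = here (≐-trans x≐∅ (≐-sym e≐∅))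
    ...   | inj₂ y≐∅ = there (here (≐-trans y≐∅ (≐-sym e≐∅)))

∅≐∅ : ∅V ≐ ∅V
∅≐∅ = ≐-refl ∅V

module _ (em : ExcludedMiddle (lsuc 0ℓ)) where

  ¬Convex-MLSS : ¬ Convex MLSS
  ¬Convex-MLSS = ¬Convex-⊆singleton em MLSS
    (pos (isEmp 0) ∷ pos (singA refl 1 0) ∷ pos (subA 2 1) ∷ [])
    (λ { M (lift e≐∅ ∷ᴬ lift x≐sing-e ∷ᴬ z⊆x ∷ᴬ []ᴬ) → e≐∅ , x≐sing-e , z⊆x })
    (λ z z⊆x → lift ∅≐∅ ∷ᴬ lift (≐-refl sing∅) ∷ᴬ z⊆x ∷ᴬ []ᴬ)

  ¬Convex-MLSP : ¬ Convex MLSP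
  ¬Convex-MLSP = ¬Convex-⊆singleton em MLSP
    (pos (isEmp 0) ∷ pos (powA refl 1 0) ∷ pos (subA 2 1) ∷ [])
    (λ { M (lift e≐∅ ∷ᴬ x≡𝒫e ∷ᴬ z⊆x ∷ᴬ []ᴬ) → e≐∅ , 𝒫-≐∅ e≐∅ x≡𝒫e , z⊆x })
    (λ z z⊆x → lift ∅≐∅ ∷ᴬ 𝒫∅ ∷ᴬ z⊆x ∷ᴬ []ᴬ)

  ¬Convex-MLSSP : ¬ Convex MLSSP
  ¬Convex-MLSSP = ¬Convex-⊆singleton em MLSSP
    (pos (isEmp 0) ∷ pos (singA (inj₁ refl) 1 0) ∷ pos (subA 2 1) ∷ [])
    (λ { M (lift e≐∅ ∷ᴬ lift x≐sing-e ∷ᴬ z⊆x ∷ᴬ []ᴬ) → e≐∅ , x≐sing-e , z⊆x })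
    (λ z z⊆x → lift ∅≐∅ ∷ᴬ lift (≐-refl sing∅) ∷ᴬ z⊆x ∷ᴬ []ᴬ)

  ¬Convex-MLSU : ¬ Convex MLSU
  ¬Convex-MLSU = ¬Convex-⊆singleton em MLSU
    (pos (isEmp 0) ∷ pos (memA 0 1) ∷ pos (bigUA refl 0 1) ∷ pos (subA 2 1) ∷ [])
    (λ { M (lift e≐∅ ∷ᴬ lift e∈x ∷ᴬ lift e≐⋃x ∷ᴬ z⊆x ∷ᴬ []ᴬ) → e≐∅ , ⋃-≐∅ e≐∅ e∈x e≐⋃x , z⊆x })
    (λ z z⊆x → lift ∅≐∅ ∷ᴬ lift (tt , ∅≐∅) ∷ᴬ lift ⋃sing∅ ∷ᴬ z⊆x ∷ᴬ []ᴬ)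

  ¬Convex-MLS× : ¬ Convex MLS×
  ¬Convex-MLS× = ¬Convex-product em MLS×
    (pos (isEmp 0) ∷ pos (isEmp 3) ∷ pos (prodA refl 3 1 2) ∷ []) _×V_ ×V-Idx
    (λ { M (lift e≐∅ ∷ᴬ lift w≐∅ ∷ᴬ lift w≐xy ∷ᴬ []ᴬ) → e≐∅ , ≐-trans (≐-sym w≐xy) w≐∅ })
    (λ x y xy≐∅ → lift ∅≐∅ ∷ᴬ lift ∅≐∅ ∷ᴬ lift (≐-sym xy≐∅) ∷ᴬ []ᴬ)

  ¬Convex-MLS⊗ : ¬ Convex MLS⊗
  ¬Convex-MLS⊗ = ¬Convex-product em MLS⊗
    (pos (isEmp 0) ∷ pos (isEmp 3) ∷ pos (uprodA refl 3 1 2) ∷ []) _⊗V_ ⊗V-Idx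
    (λ { M (lift e≐∅ ∷ᴬ lift w≐∅ ∷ᴬ lift w≐xy ∷ᴬ []ᴬ) → e≐∅ , ≐-trans (≐-sym w≐xy) w≐∅ })
    (λ x y xy≐∅ → lift ∅≐∅ ∷ᴬ lift ∅≐∅ ∷ᴬ lift (≐-sym xy≐∅) ∷ᴬ []ᴬ)

  ¬Convex-BST× : ¬ Convex BST×
  ¬Convex-BST× = ¬Convex-product em BST×
    (pos (emptyB (var 0)) ∷ pos (emptyB (prodT refl (var 1) (var 2))) ∷ []) _×V_ ×V-Idx
    (λ { M (lift e≐∅ ∷ᴬ lift xy≐∅ ∷ᴬ []ᴬ) → e≐∅ , xy≐∅ })
    (λ x y xy≐∅ → lift ∅≐∅ ∷ᴬ lift xy≐∅ ∷ᴬ []ᴬ)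

  ¬Convex-BST⊗ : ¬ Convex BST⊗
  ¬Convex-BST⊗ = ¬Convex-product em BST⊗
    (pos (emptyB (var 0)) ∷ pos (emptyB (uprodT refl (var 1) (var 2))) ∷ []) _⊗V_ ⊗V-Idx
    (λ { M (lift e≐∅ ∷ᴬ lift xy≐∅ ∷ᴬ []ᴬ) → e≐∅ , xy≐∅ })
    (λ x y xy≐∅ → lift ∅≐∅ ∷ᴬ lift xy≐∅ ∷ᴬ []ᴬ)

mainTheorem3 : ExcludedMiddle (lsuc 0ℓ) →
    ¬ Convex MLSS × ¬ Convex MLSP × ¬ Convex MLSSP × ¬ Convex MLSU ×
    ¬ Convex MLS× × ¬ Convex MLS⊗ × ¬ Convex BST× × ¬ Convex BST⊗
mainTheorem3 em =
  ¬Convex-MLSS em , ¬Convex-MLSP em , ¬Convex-MLSSP em , ¬Convex-MLSU em ,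
  ¬Convex-MLS× em , ¬Convex-MLS⊗ em , ¬Convex-BST× em , ¬Convex-BST⊗ em
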